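{- Let $m \geq 2$ and $n \geq 0$. Then $$H_{n+1}(t_1, \ldots, t_{m-1}) = \sum_{i = 0}^{m-1} \mathbf{e}_{i+1}(t_1, \ldots, t_{m-1}, 1)\, (-1)^{i}\, \frac{(q)_n}{(q)_{n-i}}\, H_{n-i}(t_1, \ldots, t_{m-1}),$$ where $\mathbf{e}_{j}(t_1,\ldots,t_{m-1},1)$ denotes the $j$-th elementary symmetric polynomial in the $m$ quantities $t_1,\ldots,t_{m-1},1$, and where $(-1)^i\frac{(q)_n}{(q)_{n-i}}$ means $(q^n-1)(q^{n-1}-1)\cdots(q^{n-i+1}-1)$, so that the terms with $i>n$ vanish.
   Context: Let $q \neq 1$ be a parameter (e.g. an indeterminate). For $n \geq 1$ put $(q)_n = (1-q)(1-q^2)\cdots(1-q^n)$, and $(q)_0 = 1$. For non-negative integers $k_1,\ldots,k_m$ with $k_1+\cdots+k_m = n$, the $q$-multinomial coefficient is $\binom{n}{k_1,\ldots,k_m}_q = \frac{(q)_n}{(q)_{k_1}\cdots(q)_{k_m}}$. For $m \geq 2$, the Rogers–Szegő polynomial in $m-1$ variables is $$H_n(t_1,\ldots,t_{m-1}) = \sum_{k_1+\cdots+k_m = n} \binom{n}{k_1,\ldots,k_m}_q t_1^{k_1}\cdots t_{m-1}^{k_{m-1}},$$ the sum over all $m$-tuples of non-negative integers summing to $n$. -}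

module Defs where

open import Level using (Level)
open import Algebra.Bundles using (CommutativeRing)
open import Data.Nat as ℕ using (ℕ; zero; suc; _∸_; _≡ᵇ_)
open import Data.Bool using (if_then_else_)
open import Data.List as List using (List; []; _∷_; _++_; map; concatMap; upTo; length; zipWith)
open import Data.Vec as Vec using (Vec; _∷ʳ_)

compositions : (m n : ℕ) → List (Vec ℕ m)
compositions zero zero = Vec.[] ∷ []
compositions zero (suc n) = []
compositions (suc m) n =
  concatMap (λ k → map (k Vec.∷_) (compositions m (n ∸ k))) (upTo (suc n))

sublists : ∀ {a} {A : Set a} → List A → List (List A)
sublists [] = [] ∷ []
sublists (x ∷ xs) = map (x ∷_) (sublists xs) ++ sublists xs

module RS {c ℓ : Level} (R : CommutativeRing c ℓ) where
  open CommutativeRing R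

  sumR : List Carrier → Carrier
  sumR = List.foldr _+_ 0#

  prodR : List Carrier → Carrier
  prodR = List.foldr _*_ 1#

  pow : Carrier → ℕ → Carrier
  pow x zero = 1#
  pow x (suc k) = x * pow x k

  qPoch : Carrier → ℕ → Carrier
  qPoch q n = prodR (map (λ j → 1# - pow q (suc j)) (upTo n))

  -- q-multinomial (q)_n / ((q)_{k₁}⋯(q)_{kₘ}), where inv k is the
  -- inverse of (q)_k (assumed to exist).
  qMultinomial : (q : Carrier) (inv : ℕ → Carrier) (n : ℕ) {m : ℕ} → Vec ℕ m → Carrier
  qMultinomial q inv n ks = qPoch q n * prodR (map inv (Vec.toList ks))

  -- Rogers–Szegő polynomial H_n(t₁,…,t_d) with m = d+1 summation indices:
  -- Σ_{k₁+⋯+k_{d+1}=n} [n; k]_q t₁^{k₁}⋯t_d^{k_d}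
  -- (the last index k_{d+1} carries the factor 1^{k_{d+1}} = 1).
  H : (q : Carrier) (inv : ℕ → Carrier) {d : ℕ} → Vec Carrier d → ℕ → Carrier
  H q inv {d} t n =
    sumR (map (λ ks → qMultinomial q inv n ks *
                      prodR (zipWith pow (Vec.toList (t ∷ʳ 1#)) (Vec.toList ks)))
              (compositions (suc d) n))

  elemSym : ℕ → List Carrier → Carrier
  elemSym j xs =
    sumR (map (λ ys → if length ys ≡ᵇ j then prodR ys else 0#) (sublists xs))

  -- (-1)^i (q)_n/(q)_{n-i} := (qⁿ-1)(q^{n-1}-1)⋯(q^{n-i+1}-1)
  fallingCoeff : Carrier → ℕ → ℕ → Carrier
  fallingCoeff q n i = prodR (map (λ j → pow q (n ∸ j) - 1#) (upTo i))

module Submission where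

-- Let x = (t₁,…,t_{m-1},1), let e_q(z) = Σ_k z^k/(q)_k be
-- the q-exponential and G(z) = e_q(x₁z)⋯e_q(x_m z) (a Cauchy product of
-- coefficient sequences).  By the q-multinomial expansion H_n = (q)_n G_n.
--   1. e_q satisfies the q-difference equation e_q(qyz) = (1 - yz) e_q(yz).
--   2. The dilation z ↦ qz is multiplicative for the Cauchy product, hence
--      G(qz) = Π_i (1 - x_i z) · G(z) = (Σ_j (-1)^j e_j(x) z^j) · G(z).
--   3. Comparing coefficients of z^{n+1}:
--        (1 - q^{n+1}) G_{n+1} = Σ_{i≤n} (-1)^i e_{i+1}(x) G_{n-i}.
--   4. Multiplying by (q)_n and using (-1)^i (q)_n = [(q^n-1)⋯(q^{n-i+1}-1)] (q)_{n-i}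
--      turns this into the theorem, summed over i ≤ n; the range is then
--      changed to i < m, since the terms with i > n (falling factor) and
--      with i ≥ m (e_{i+1} of m quantities) vanish.

open import Defs
open import Level using (Level)
open import Algebra.Bundles using (CommutativeRing)
open import Data.Nat using (ℕ; zero; suc; _≡ᵇ_; _≤_; _∸_; _<_; s≤s; _≤′_; ≤′-refl; ≤′-step)
  renaming (_+_ to _+ℕ_)
open import Data.Bool using (Bool; true; false; if_then_else_)
open import Data.List using (List; []; _∷_; _++_; map; concatMap; upTo; length; zipWith)
import Data.List.Properties as ListP
import Data.Nat.Properties as ℕP
open import Data.Vec as Vec using (Vec; _∷ʳ_)
import Data.Vec.Properties as VecP
open import Function using (_∘_)
import Relation.Binary.PropositionalEquality as P
import Algebra.Solver.Ring.NaturalCoefficients.Default as NaturalSolver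

module RogersSzegő {c ℓ : Level} (R : CommutativeRing c ℓ) where
  open CommutativeRing R
  open RS R
  open import Relation.Binary.Reasoning.Setoid setoid
  open import Algebra.Properties.Ring ring using (-1*x≈-x; -‿distribˡ-*; [y-z]x≈yx-zx)
  open import Algebra.Properties.AbelianGroup +-abelianGroup using (⁻¹-∙-comm; ⁻¹-anti-homo‿-; ε⁻¹≈ε)
  open NaturalSolver commutativeSemiring using (solve; _:+_; _:*_; _:=_; con)

  x-[x-y]≈y : ∀ x y → x - (x - y) ≈ y
  x-[x-y]≈y x y = begin
    x + - (x + - y) ≈⟨ +-congˡ (⁻¹-anti-homo‿- x y) ⟩
    x + (y + - x)   ≈⟨ +-congˡ (+-comm y (- x)) ⟩
    x + (- x + y)   ≈⟨ sym (+-assoc _ _ _) ⟩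
    (x + - x) + y   ≈⟨ +-congʳ (-‿inverseʳ x) ⟩
    0# + y          ≈⟨ +-identityˡ y ⟩
    y               ∎

  [1-a]b≈b-ab : ∀ a b → (1# - a) * b ≈ b - a * b
  [1-a]b≈b-ab a b = trans ([y-z]x≈yx-zx b 1# a) (+-congʳ (*-identityˡ b))

  -1*[a-b]≈b-a : ∀ a b → - 1# * (a - b) ≈ b - a
  -1*[a-b]≈b-a a b = trans (-1*x≈-x _) (⁻¹-anti-homo‿- a b)

  sumR-++ : ∀ xs ys → sumR (xs ++ ys) ≈ sumR xs + sumR ys
  sumR-++ [] ys = sym (+-identityˡ _)
  sumR-++ (x ∷ xs) ys = trans (+-congˡ (sumR-++ xs ys)) (sym (+-assoc _ _ _))

  prodR-++ : ∀ xs ys → prodR (xs ++ ys) ≈ prodR xs * prodR ys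
  prodR-++ [] ys = sym (*-identityˡ _)
  prodR-++ (x ∷ xs) ys = trans (*-congˡ (prodR-++ xs ys)) (sym (*-assoc _ _ _))

  module _ {a} {A : Set a} where
    sumR-map-++ : ∀ (f : A → Carrier) xs ys →
      sumR (map f (xs ++ ys)) ≈ sumR (map f xs) + sumR (map f ys)
    sumR-map-++ f xs ys = trans (reflexive (P.cong sumR (ListP.map-++ f xs ys))) (sumR-++ (map f xs) (map f ys))

    sumR-map-cong : ∀ {f g : A → Carrier} → (∀ x → f x ≈ g x) → ∀ xs → sumR (map f xs) ≈ sumR (map g xs)
    sumR-map-cong f≈g [] = refl
    sumR-map-cong f≈g (x ∷ xs) = +-cong (f≈g x) (sumR-map-cong f≈g xs)

    sumR-map-scale : ∀ k (f : A → Carrier) xs → sumR (map (λ x → k * f x) xs) ≈ k * sumR (map f xs)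
    sumR-map-scale k f [] = sym (zeroʳ k)
    sumR-map-scale k f (x ∷ xs) = trans (+-congˡ (sumR-map-scale k f xs)) (sym (distribˡ k _ _))

    sumR-map-zero : ∀ (f : A → Carrier) → (∀ x → f x ≈ 0#) → ∀ xs → sumR (map f xs) ≈ 0#
    sumR-map-zero f f≈0 [] = refl
    sumR-map-zero f f≈0 (x ∷ xs) = trans (+-cong (f≈0 x) (sumR-map-zero f f≈0 xs)) (+-identityˡ 0#)

  module _ {a b} {A : Set a} {B : Set b} where
    sumR-map-∘ : ∀ (f : B → Carrier) (g : A → B) xs → sumR (map f (map g xs)) ≈ sumR (map (f ∘ g) xs)
    sumR-map-∘ f g xs = reflexive (P.cong sumR (P.sym (ListP.map-∘ xs)))

    sumR-map-concatMap : ∀ (f : B → Carrier) (g : A → List B) xs →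
      sumR (map f (concatMap g xs)) ≈ sumR (map (λ x → sumR (map f (g x))) xs)
    sumR-map-concatMap f g [] = refl
    sumR-map-concatMap f g (x ∷ xs) =
      trans (sumR-map-++ f (g x) (concatMap g xs)) (+-congˡ (sumR-map-concatMap f g xs))

  sumBelow : (ℕ → Carrier) → ℕ → Carrier
  sumBelow f zero = 0#
  sumBelow f (suc n) = sumBelow f n + f n

  sumR-upTo : ∀ (f : ℕ → Carrier) n → sumR (map f (upTo n)) ≈ sumBelow f n
  sumR-upTo f zero = refl
  sumR-upTo f (suc n) = begin
    sumR (map f (upTo (suc n)))        ≈⟨ reflexive (P.cong (sumR ∘ map f) (P.sym (ListP.upTo-∷ʳ n))) ⟩
    sumR (map f (upTo n ++ n ∷ []))    ≈⟨ sumR-map-++ f (upTo n) (n ∷ []) ⟩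
    sumR (map f (upTo n)) + (f n + 0#) ≈⟨ +-cong (sumR-upTo f n) (+-identityʳ _) ⟩
    sumBelow f n + f n                 ∎

  prodR-upTo-suc : ∀ (f : ℕ → Carrier) n → prodR (map f (upTo (suc n))) ≈ prodR (map f (upTo n)) * f n
  prodR-upTo-suc f n = begin
    prodR (map f (upTo (suc n)))           ≈⟨ reflexive (P.cong (prodR ∘ map f) (P.sym (ListP.upTo-∷ʳ n))) ⟩
    prodR (map f (upTo n ++ n ∷ []))       ≈⟨ reflexive (P.cong prodR (ListP.map-++ f (upTo n) (n ∷ []))) ⟩
    prodR (map f (upTo n) ++ f n ∷ [])     ≈⟨ prodR-++ (map f (upTo n)) (f n ∷ []) ⟩
    prodR (map f (upTo n)) * (f n * 1#)    ≈⟨ *-congˡ (*-identityʳ _) ⟩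
    prodR (map f (upTo n)) * f n           ∎

  sumBelow-cong< : ∀ {f g : ℕ → Carrier} n → (∀ i → i < n → f i ≈ g i) → sumBelow f n ≈ sumBelow g n
  sumBelow-cong< zero f≈g = refl
  sumBelow-cong< (suc n) f≈g =
    +-cong (sumBelow-cong< n (λ i i<n → f≈g i (ℕP.m<n⇒m<1+n i<n))) (f≈g n (ℕP.n<1+n n))

  sumBelow-scale : ∀ k (f : ℕ → Carrier) n → sumBelow (λ i → k * f i) n ≈ k * sumBelow f n
  sumBelow-scale k f zero = sym (zeroʳ k)
  sumBelow-scale k f (suc n) = trans (+-congʳ (sumBelow-scale k f n)) (sym (distribˡ k _ _))

  sumBelow-neg : ∀ (f : ℕ → Carrier) n → sumBelow (λ i → - f i) n ≈ - sumBelow f n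
  sumBelow-neg f zero = sym ε⁻¹≈ε
  sumBelow-neg f (suc n) = trans (+-congʳ (sumBelow-neg f n)) (⁻¹-∙-comm _ _)

  sumBelow-shift : ∀ (f : ℕ → Carrier) n → sumBelow f (suc n) ≈ f 0 + sumBelow (f ∘ suc) n
  sumBelow-shift f zero = trans (+-identityˡ _) (sym (+-identityʳ _))
  sumBelow-shift f (suc n) = trans (+-congʳ (sumBelow-shift f n)) (+-assoc _ _ _)

  sumBelow-extend : ∀ (f : ℕ → Carrier) a → (∀ j → a ≤ j → f j ≈ 0#) → ∀ k → sumBelow f (k +ℕ a) ≈ sumBelow f a
  sumBelow-extend f a f≈0 zero = refl
  sumBelow-extend f a f≈0 (suc k) =
    trans (+-cong (sumBelow-extend f a f≈0 k) (f≈0 (k +ℕ a) (ℕP.m≤n+m a k))) (+-identityʳ _)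

  sumBelow-range : ∀ (f : ℕ → Carrier) {a b} → (∀ j → a ≤ j → f j ≈ 0#) → (∀ j → b ≤ j → f j ≈ 0#) →
    sumBelow f a ≈ sumBelow f b
  sumBelow-range f {a} {b} f≈0-from-a f≈0-from-b = begin
    sumBelow f a        ≈⟨ sym (sumBelow-extend f a f≈0-from-a b) ⟩
    sumBelow f (b +ℕ a) ≈⟨ reflexive (P.cong (sumBelow f) (ℕP.+-comm b a)) ⟩
    sumBelow f (a +ℕ b) ≈⟨ sumBelow-extend f b f≈0-from-b a ⟩
    sumBelow f b        ∎

  -- Formal power series, represented by their coefficient sequences,
  -- with coefficientwise equality and the Cauchy product.
  Series : Set c
  Series = ℕ → Carrier

  infix 4 _≋_
  _≋_ : Series → Series → Set ℓ
  A ≋ B = ∀ k → A k ≈ B k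

  infixl 7 _⋆_
  _⋆_ : Series → Series → Series
  (A ⋆ B) zero = A 0 * B 0
  (A ⋆ B) (suc N) = A 0 * B (suc N) + ((A ∘ suc) ⋆ B) N

  ⋆-as-sum : ∀ (A B : Series) N → (A ⋆ B) N ≈ sumBelow (λ k → A k * B (N ∸ k)) (suc N)
  ⋆-as-sum A B zero = sym (+-identityˡ _)
  ⋆-as-sum A B (suc N) =
    trans (+-congˡ (⋆-as-sum (A ∘ suc) B N)) (sym (sumBelow-shift (λ k → A k * B (suc N ∸ k)) (suc N)))

  ⋆-cong : ∀ {A A′ B B′ : Series} → A ≋ A′ → B ≋ B′ → A ⋆ B ≋ A′ ⋆ B′
  ⋆-cong A≋A′ B≋B′ zero = *-cong (A≋A′ 0) (B≋B′ 0)
  ⋆-cong A≋A′ B≋B′ (suc N) = +-cong (*-cong (A≋A′ 0) (B≋B′ (suc N))) (⋆-cong (A≋A′ ∘ suc) B≋B′ N)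

  ⋆-zeroˡ : ∀ (A B : Series) → (∀ k → A k ≈ 0#) → ∀ N → (A ⋆ B) N ≈ 0#
  ⋆-zeroˡ A B A≈0 zero = trans (*-congʳ (A≈0 0)) (zeroˡ _)
  ⋆-zeroˡ A B A≈0 (suc N) =
    trans (+-cong (trans (*-congʳ (A≈0 0)) (zeroˡ _)) (⋆-zeroˡ (A ∘ suc) B (A≈0 ∘ suc) N)) (+-identityˡ 0#)

  ⋆-scaleˡ : ∀ k (A B : Series) → (λ i → k * A i) ⋆ B ≋ (λ N → k * (A ⋆ B) N)
  ⋆-scaleˡ k A B zero = *-assoc _ _ _
  ⋆-scaleˡ k A B (suc N) = trans (+-cong (*-assoc _ _ _) (⋆-scaleˡ k (A ∘ suc) B N)) (sym (distribˡ k _ _))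

  ⋆-distribʳ : ∀ (A A′ B : Series) → (λ i → A i + A′ i) ⋆ B ≋ (λ N → (A ⋆ B) N + (A′ ⋆ B) N)
  ⋆-distribʳ A A′ B zero = distribʳ _ _ _
  ⋆-distribʳ A A′ B (suc N) = trans (+-cong (distribʳ _ _ _) (⋆-distribʳ (A ∘ suc) (A′ ∘ suc) B N))
    (solve 4 (λ a b c d → (a :+ b) :+ (c :+ d) := (a :+ c) :+ (b :+ d)) refl _ _ _ _)

  ⋆-assoc : ∀ (A B C : Series) → (A ⋆ B) ⋆ C ≋ A ⋆ (B ⋆ C)
  ⋆-assoc A B C zero = *-assoc _ _ _
  ⋆-assoc A B C (suc N) = begin
    (A ⋆ B) 0 * C (suc N) + ((λ k → A 0 * B (suc k) + ((A ∘ suc) ⋆ B) k) ⋆ C) N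
      ≈⟨ +-congˡ (⋆-distribʳ (λ k → A 0 * B (suc k)) ((A ∘ suc) ⋆ B) C N) ⟩
    (A ⋆ B) 0 * C (suc N) + (((λ k → A 0 * B (suc k)) ⋆ C) N + (((A ∘ suc) ⋆ B) ⋆ C) N)
      ≈⟨ +-congˡ (+-cong (⋆-scaleˡ (A 0) (B ∘ suc) C N) (⋆-assoc (A ∘ suc) B C N)) ⟩
    (A 0 * B 0) * C (suc N) + (A 0 * ((B ∘ suc) ⋆ C) N + ((A ∘ suc) ⋆ (B ⋆ C)) N)
      ≈⟨ solve 5 (λ a b c x y → (a :* b) :* c :+ (a :* x :+ y) := a :* (b :* c :+ x) :+ y) refl _ _ _ _ _ ⟩
    A 0 * (B ⋆ C) (suc N) + ((A ∘ suc) ⋆ (B ⋆ C)) N ∎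

  ⋆-comm : ∀ (A B : Series) → A ⋆ B ≋ B ⋆ A
  ⋆-comm A B zero = *-comm _ _
  ⋆-comm A B (suc zero) = solve 4 (λ a0 a1 b0 b1 → a0 :* b1 :+ a1 :* b0 := b0 :* a1 :+ b1 :* a0) refl _ _ _ _
  ⋆-comm A B (suc (suc N)) = begin
    A 0 * B (2 +ℕ N) + ((A ∘ suc) ⋆ B) (suc N)
      ≈⟨ +-congˡ (⋆-comm (A ∘ suc) B (suc N)) ⟩
    A 0 * B (2 +ℕ N) + (B 0 * A (2 +ℕ N) + ((B ∘ suc) ⋆ (A ∘ suc)) N)
      ≈⟨ +-congˡ (+-congˡ (⋆-comm (B ∘ suc) (A ∘ suc) N)) ⟩
    A 0 * B (2 +ℕ N) + (B 0 * A (2 +ℕ N) + ((A ∘ suc) ⋆ (B ∘ suc)) N)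
      ≈⟨ solve 5 (λ a b c d x → a :* b :+ (c :* d :+ x) := c :* d :+ (a :* b :+ x)) refl _ _ _ _ _ ⟩
    B 0 * A (2 +ℕ N) + (A 0 * B (2 +ℕ N) + ((A ∘ suc) ⋆ (B ∘ suc)) N)
      ≈⟨ +-congˡ (sym (⋆-comm (B ∘ suc) A (suc N))) ⟩
    B 0 * A (2 +ℕ N) + ((B ∘ suc) ⋆ A) (suc N) ∎

  linearFactor : Carrier → Series
  linearFactor y zero = 1#
  linearFactor y (suc zero) = - y
  linearFactor y (suc (suc k)) = 0#

  linearFactor-⋆ : ∀ y (A : Series) k → (linearFactor y ⋆ A) (suc k) ≈ A (suc k) - y * A k
  linearFactor-⋆ y A k = +-cong (*-identityˡ _) (tail k)
    where
      tail : ∀ k → ((linearFactor y ∘ suc) ⋆ A) k ≈ - (y * A k)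
      tail zero = sym (-‿distribˡ-* y (A 0))
      tail (suc k) = trans (+-congˡ (⋆-zeroˡ (linearFactor y ∘ suc ∘ suc) A (λ _ → refl) k))
                           (trans (+-identityʳ _) (sym (-‿distribˡ-* y (A (suc k)))))

  -- Elementary symmetric functions: sublists of y ∷ ys either contain the
  -- head y or not, giving e_{j+1}(y ∷ ys) = e_{j+1}(ys) + y e_j(ys).
  private
    elemSym-split : ∀ j y ys → elemSym j (y ∷ ys) ≈
      sumR (map (λ zs → if length (y ∷ zs) ≡ᵇ j then prodR (y ∷ zs) else 0#) (sublists ys)) + elemSym j ys
    elemSym-split j y ys = trans (sumR-map-++ f (map (y ∷_) (sublists ys)) (sublists ys))
                                 (+-congʳ (sumR-map-∘ f (y ∷_) (sublists ys)))
      where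
        f : List Carrier → Carrier
        f zs = if length zs ≡ᵇ j then prodR zs else 0#

    if-scale : ∀ (b : Bool) y p → (if b then y * p else 0#) ≈ y * (if b then p else 0#)
    if-scale true y p = refl
    if-scale false y p = sym (zeroʳ y)

  elemSym-zero : ∀ ys → elemSym 0 ys ≈ 1#
  elemSym-zero [] = +-identityʳ 1#
  elemSym-zero (y ∷ ys) = begin
    elemSym 0 (y ∷ ys) ≈⟨ elemSym-split 0 y ys ⟩
    sumR (map (λ _ → 0#) (sublists ys)) + elemSym 0 ys
      ≈⟨ +-congʳ (sumR-map-zero (λ _ → 0#) (λ _ → refl) (sublists ys)) ⟩
    0# + elemSym 0 ys ≈⟨ +-identityˡ _ ⟩
    elemSym 0 ys ≈⟨ elemSym-zero ys ⟩
    1# ∎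

  elemSym-cons : ∀ j y ys → elemSym (suc j) (y ∷ ys) ≈ elemSym (suc j) ys + y * elemSym j ys
  elemSym-cons j y ys = trans (elemSym-split (suc j) y ys) (trans (+-comm _ _) (+-congˡ
    (trans (sumR-map-cong (λ zs → if-scale (length zs ≡ᵇ j) y (prodR zs)) (sublists ys))
           (sumR-map-scale y (λ zs → if length zs ≡ᵇ j then prodR zs else 0#) (sublists ys)))))

  elemSym-vanish : ∀ ys j → length ys < j → elemSym j ys ≈ 0#
  elemSym-vanish [] (suc j) _ = +-identityˡ 0#
  elemSym-vanish (y ∷ ys) (suc j) (s≤s ys<j) = begin
    elemSym (suc j) (y ∷ ys)             ≈⟨ elemSym-cons j y ys ⟩
    elemSym (suc j) ys + y * elemSym j ys
      ≈⟨ +-cong (elemSym-vanish ys (suc j) (ℕP.m<n⇒m<1+n ys<j)) (*-congˡ (elemSym-vanish ys j ys<j)) ⟩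
    0# + y * 0#                          ≈⟨ trans (+-identityˡ _) (zeroʳ y) ⟩
    0#                                   ∎

  signedElem : List Carrier → Series
  signedElem ys j = pow (- 1#) j * elemSym j ys

  signedElem-cons : ∀ y ys → signedElem (y ∷ ys) ≋ linearFactor y ⋆ signedElem ys
  signedElem-cons y ys zero = *-congˡ (trans (elemSym-zero (y ∷ ys)) (sym (trans (*-identityˡ _) (elemSym-zero ys))))
  signedElem-cons y ys (suc j) = begin
    (- 1# * s) * elemSym (suc j) (y ∷ ys)           ≈⟨ *-congˡ (elemSym-cons j y ys) ⟩
    (- 1# * s) * (elemSym (suc j) ys + y * elemSym j ys)
      ≈⟨ solve 5 (λ m s a y b → (m :* s) :* (a :+ y :* b) := (m :* s) :* a :+ m :* (y :* (s :* b))) refl _ _ _ _ _ ⟩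
    signedElem ys (suc j) + - 1# * (y * signedElem ys j) ≈⟨ +-congˡ (-1*x≈-x _) ⟩
    signedElem ys (suc j) - y * signedElem ys j      ≈⟨ sym (linearFactor-⋆ y (signedElem ys) j) ⟩
    (linearFactor y ⋆ signedElem ys) (suc j)        ∎
    where
      s : Carrier
      s = pow (- 1#) j

  module QCalculus (q : Carrier) where

    dilate : Series → Series
    dilate A k = pow q k * A k

    dilate-⋆ : ∀ (A B : Series) → dilate A ⋆ dilate B ≋ dilate (A ⋆ B)
    dilate-⋆ A B zero = solve 2 (λ a b → (con 1 :* a) :* (con 1 :* b) := con 1 :* (a :* b)) refl _ _
    dilate-⋆ A B (suc N) = begin
      (1# * A 0) * (q * pow q N * B (suc N)) + ((dilate A ∘ suc) ⋆ dilate B) N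
        ≈⟨ +-congˡ (⋆-cong {B = dilate B} (λ k → *-assoc _ _ _) (λ k → refl) N) ⟩
      (1# * A 0) * (q * pow q N * B (suc N)) + ((λ k → q * dilate (A ∘ suc) k) ⋆ dilate B) N
        ≈⟨ +-congˡ (⋆-scaleˡ q (dilate (A ∘ suc)) (dilate B) N) ⟩
      (1# * A 0) * (q * pow q N * B (suc N)) + q * (dilate (A ∘ suc) ⋆ dilate B) N
        ≈⟨ +-congˡ (*-congˡ (dilate-⋆ (A ∘ suc) B N)) ⟩
      (1# * A 0) * (q * pow q N * B (suc N)) + q * (pow q N * ((A ∘ suc) ⋆ B) N)
        ≈⟨ solve 5 (λ a q′ p b x → (con 1 :* a) :* (q′ :* p :* b) :+ q′ :* (p :* x)
                                   := (q′ :* p) :* (a :* b :+ x)) refl _ _ _ _ _ ⟩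
      (q * pow q N) * (A 0 * B (suc N) + ((A ∘ suc) ⋆ B) N) ∎

    qPoch-suc : ∀ k → qPoch q (suc k) ≈ qPoch q k * (1# - pow q (suc k))
    qPoch-suc k = prodR-upTo-suc (λ j → 1# - pow q (suc j)) k

    fallingCoeff-suc : ∀ n i → fallingCoeff q n (suc i) ≈ fallingCoeff q n i * (pow q (n ∸ i) - 1#)
    fallingCoeff-suc n i = prodR-upTo-suc (λ j → pow q (n ∸ j) - 1#) i

    -- (q^n - 1)⋯(q^{n-i+1} - 1) = 0 once i > n, because of the factor q^0 - 1.
    fallingCoeff-vanish : ∀ n i → n < i → fallingCoeff q n i ≈ 0#
    fallingCoeff-vanish n (suc i) (s≤s n≤i) = vanish (ℕP.≤⇒≤′ n≤i)
      where
        vanish : ∀ {i} → n ≤′ i → fallingCoeff q n (suc i) ≈ 0#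
        vanish ≤′-refl = begin
          fallingCoeff q n (suc n)                     ≈⟨ fallingCoeff-suc n n ⟩
          fallingCoeff q n n * (pow q (n ∸ n) - 1#)    ≈⟨ *-congˡ (+-congʳ (reflexive (P.cong (pow q) (ℕP.n∸n≡0 n)))) ⟩
          fallingCoeff q n n * (1# - 1#)               ≈⟨ trans (*-congˡ (-‿inverseʳ 1#)) (zeroʳ _) ⟩
          0#                                           ∎
        vanish {suc i} (≤′-step n≤i) =
          trans (fallingCoeff-suc n (suc i)) (trans (*-congʳ (vanish n≤i)) (zeroˡ _))

    -- (-1)^i (q)_n = (q^n - 1)⋯(q^{n-i+1} - 1) · (q)_{n-i}, first for n = i + k.
    private
      sign-qPoch-+ : ∀ i k → pow (- 1#) i * qPoch q (i +ℕ k) ≈ fallingCoeff q (i +ℕ k) i * qPoch q k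
      sign-qPoch-+ zero k = refl
      sign-qPoch-+ (suc i) k = begin
        (- 1# * s) * qPoch q (suc (i +ℕ k))   ≈⟨ *-assoc _ _ _ ⟩
        - 1# * (s * qPoch q (suc (i +ℕ k)))   ≈⟨ *-congˡ IH ⟩
        - 1# * (X * (qPoch q k * (1# - Qk)))
          ≈⟨ solve 4 (λ m x p w → m :* (x :* (p :* w)) := x :* p :* (m :* w)) refl _ _ _ _ ⟩
        X * qPoch q k * (- 1# * (1# - Qk))    ≈⟨ *-congˡ (-1*[a-b]≈b-a 1# Qk) ⟩
        X * qPoch q k * (Qk - 1#)             ≈⟨ solve 3 (λ x p w → x :* p :* w := x :* w :* p) refl _ _ _ ⟩
        X * (Qk - 1#) * qPoch q k
          ≈⟨ *-congʳ (sym (trans (fallingCoeff-suc (suc (i +ℕ k)) i)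
                                 (*-congˡ (+-congʳ (reflexive (P.cong (pow q) top-exponent)))))) ⟩
        fallingCoeff q (suc (i +ℕ k)) (suc i) * qPoch q k ∎
        where
          s X Qk : Carrier
          s = pow (- 1#) i
          X = fallingCoeff q (suc (i +ℕ k)) i
          Qk = pow q (suc k)
          top-exponent : suc (i +ℕ k) ∸ i P.≡ suc k
          top-exponent = P.trans (P.cong (_∸ i) (P.sym (ℕP.+-suc i k))) (ℕP.m+n∸m≡n i (suc k))
          IH : s * qPoch q (suc (i +ℕ k)) ≈ X * (qPoch q k * (1# - Qk))
          IH = P.subst (λ N → s * qPoch q N ≈ fallingCoeff q N i * (qPoch q k * (1# - Qk))) (ℕP.+-suc i k)
                 (trans (sign-qPoch-+ i (suc k)) (*-congˡ (qPoch-suc k)))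

    sign-qPoch : ∀ {i n} → i ≤ n → pow (- 1#) i * qPoch q n ≈ fallingCoeff q n i * qPoch q (n ∸ i)
    sign-qPoch {i} {n} i≤n = P.subst (λ N → pow (- 1#) i * qPoch q N ≈ fallingCoeff q N i * qPoch q (n ∸ i))
                                     (ℕP.m+[n∸m]≡n i≤n) (sign-qPoch-+ i (n ∸ i))

    module QExponential (inv : ℕ → Carrier) (inv-correct : ∀ k → qPoch q k * inv k ≈ 1#) where

      inv-suc : ∀ k → inv k ≈ (1# - pow q (suc k)) * inv (suc k)
      inv-suc k = begin
        inv k                                    ≈⟨ sym (*-identityʳ _) ⟩
        inv k * 1#                               ≈⟨ *-congˡ (sym (inv-correct (suc k))) ⟩
        inv k * (qPoch q (suc k) * inv (suc k))  ≈⟨ *-congˡ (*-congʳ (qPoch-suc k)) ⟩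
        inv k * ((qPoch q k * W) * inv (suc k))
          ≈⟨ solve 4 (λ a p w b → a :* ((p :* w) :* b) := (p :* a) :* (w :* b)) refl _ _ _ _ ⟩
        (qPoch q k * inv k) * (W * inv (suc k))  ≈⟨ *-congʳ (inv-correct k) ⟩
        1# * (W * inv (suc k))                   ≈⟨ *-identityˡ _ ⟩
        W * inv (suc k)                          ∎
        where
          W : Carrier
          W = 1# - pow q (suc k)

      qExp : Carrier → Series
      qExp y k = pow y k * inv k

      qExp-dilate : ∀ y → dilate (qExp y) ≋ linearFactor y ⋆ qExp y
      qExp-dilate y zero = refl
      qExp-dilate y (suc k) = sym (begin
        (linearFactor y ⋆ qExp y) (suc k) ≈⟨ linearFactor-⋆ y (qExp y) k ⟩
        u - y * (pow y k * inv k)         ≈⟨ +-congˡ (-‿cong (*-congˡ (*-congˡ (inv-suc k)))) ⟩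
        u - y * (pow y k * (W * inv (suc k)))
          ≈⟨ +-congˡ (-‿cong (solve 4 (λ y p w c → y :* (p :* (w :* c)) := w :* ((y :* p) :* c)) refl _ _ _ _)) ⟩
        u - W * u                         ≈⟨ +-congˡ (-‿cong ([1-a]b≈b-ab Qk u)) ⟩
        u - (u - Qk * u)                  ≈⟨ x-[x-y]≈y u (Qk * u) ⟩
        Qk * u                            ∎)
        where
          u Qk W : Carrier
          u = pow y (suc k) * inv (suc k)
          Qk = pow q (suc k)
          W = 1# - Qk

      qExpProduct : ∀ {m} → Vec Carrier m → Series
      qExpProduct Vec.[] zero = 1#
      qExpProduct Vec.[] (suc N) = 0#
      qExpProduct (y Vec.∷ xs) = qExp y ⋆ qExpProduct xs

      qExpProduct-dilate : ∀ {m} (xs : Vec Carrier m) →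
        dilate (qExpProduct xs) ≋ signedElem (Vec.toList xs) ⋆ qExpProduct xs
      qExpProduct-dilate Vec.[] zero = *-congʳ (sym (trans (*-identityˡ _) (+-identityʳ _)))
      qExpProduct-dilate Vec.[] (suc N) = trans (zeroʳ _) (sym (trans (+-cong (zeroʳ _)
        (⋆-zeroˡ (signedElem [] ∘ suc) (qExpProduct Vec.[]) (λ k → trans (*-congˡ (+-identityˡ 0#)) (zeroʳ _)) N))
        (+-identityˡ 0#)))
      qExpProduct-dilate (y Vec.∷ xs) N = begin
        dilate (Y ⋆ G) N                ≈⟨ sym (dilate-⋆ Y G N) ⟩
        (dilate Y ⋆ dilate G) N         ≈⟨ ⋆-cong (qExp-dilate y) (qExpProduct-dilate xs) N ⟩
        ((L ⋆ Y) ⋆ (E ⋆ G)) N           ≈⟨ ⋆-assoc L Y (E ⋆ G) N ⟩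
        (L ⋆ (Y ⋆ (E ⋆ G))) N           ≈⟨ ⋆-cong (λ _ → refl) (λ k → sym (⋆-assoc Y E G k)) N ⟩
        (L ⋆ ((Y ⋆ E) ⋆ G)) N           ≈⟨ ⋆-cong (λ _ → refl) (⋆-cong (⋆-comm Y E) (λ _ → refl)) N ⟩
        (L ⋆ ((E ⋆ Y) ⋆ G)) N           ≈⟨ ⋆-cong (λ _ → refl) (⋆-assoc E Y G) N ⟩
        (L ⋆ (E ⋆ (Y ⋆ G))) N           ≈⟨ sym (⋆-assoc L E (Y ⋆ G) N) ⟩
        ((L ⋆ E) ⋆ (Y ⋆ G)) N           ≈⟨ ⋆-cong (λ k → sym (signedElem-cons y (Vec.toList xs) k)) (λ _ → refl) N ⟩
        (signedElem (y ∷ Vec.toList xs) ⋆ (Y ⋆ G)) N ∎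
        where
          Y G L E : Series
          Y = qExp y
          G = qExpProduct xs
          L = linearFactor y
          E = signedElem (Vec.toList xs)

      qExpProduct-recurrence : ∀ {m} (xs : Vec Carrier m) n →
        (1# - pow q (suc n)) * qExpProduct xs (suc n) ≈
        sumBelow (λ i → (pow (- 1#) i * elemSym (suc i) (Vec.toList xs)) * qExpProduct xs (n ∸ i)) (suc n)
      qExpProduct-recurrence xs n = begin
        (1# - pow q (suc n)) * G (suc n)                 ≈⟨ [1-a]b≈b-ab _ _ ⟩
        G (suc n) - dilate G (suc n)                     ≈⟨ +-congˡ (-‿cong (qExpProduct-dilate xs (suc n))) ⟩
        G (suc n) - (E 0 * G (suc n) + ((E ∘ suc) ⋆ G) n) ≈⟨ +-congˡ (-‿cong (+-cong leading rest)) ⟩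
        G (suc n) - (G (suc n) - sumBelow term (suc n))  ≈⟨ x-[x-y]≈y _ _ ⟩
        sumBelow term (suc n)                            ∎
        where
          G E : Series
          G = qExpProduct xs
          E = signedElem (Vec.toList xs)
          term : ℕ → Carrier
          term i = (pow (- 1#) i * elemSym (suc i) (Vec.toList xs)) * G (n ∸ i)
          leading : E 0 * G (suc n) ≈ G (suc n)
          leading = trans (*-congʳ (trans (*-identityˡ _) (elemSym-zero (Vec.toList xs)))) (*-identityˡ _)
          rest : ((E ∘ suc) ⋆ G) n ≈ - sumBelow term (suc n)
          rest = trans (⋆-as-sum (E ∘ suc) G n)
            (trans (sumBelow-cong< (suc n) (λ i _ → trans (*-congʳ (*-assoc _ _ _)) (trans (*-assoc _ _ _) (-1*x≈-x _))))
                   (sumBelow-neg term (suc n)))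

      compositionWeight : ∀ {m} → Vec Carrier m → Vec ℕ m → Carrier
      compositionWeight xs ks =
        prodR (map inv (Vec.toList ks)) * prodR (zipWith pow (Vec.toList xs) (Vec.toList ks))

      compositions-sum : ∀ {m} (xs : Vec Carrier m) n →
        sumR (map (compositionWeight xs) (compositions m n)) ≈ qExpProduct xs n
      compositions-sum Vec.[] zero = trans (+-identityʳ _) (*-identityˡ _)
      compositions-sum Vec.[] (suc n) = refl
      compositions-sum {suc m} (y Vec.∷ xs) n = begin
        sumR (map W (concatMap extend (upTo (suc n))))
          ≈⟨ sumR-map-concatMap W extend (upTo (suc n)) ⟩
        sumR (map (λ k → sumR (map W (extend k))) (upTo (suc n)))
          ≈⟨ sumR-map-cong first-part (upTo (suc n)) ⟩
        sumR (map (λ k → qExp y k * qExpProduct xs (n ∸ k)) (upTo (suc n)))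
          ≈⟨ sumR-upTo _ (suc n) ⟩
        sumBelow (λ k → qExp y k * qExpProduct xs (n ∸ k)) (suc n)
          ≈⟨ sym (⋆-as-sum (qExp y) (qExpProduct xs) n) ⟩
        (qExp y ⋆ qExpProduct xs) n ∎
        where
          W : Vec ℕ (suc m) → Carrier
          W = compositionWeight (y Vec.∷ xs)
          extend : ℕ → List (Vec ℕ (suc m))
          extend k = map (k Vec.∷_) (compositions m (n ∸ k))
          first-part : ∀ k → sumR (map W (extend k)) ≈ qExp y k * qExpProduct xs (n ∸ k)
          first-part k = begin
            sumR (map W (extend k))  ≈⟨ sumR-map-∘ W (k Vec.∷_) (compositions m (n ∸ k)) ⟩
            sumR (map (W ∘ (k Vec.∷_)) (compositions m (n ∸ k)))
              ≈⟨ sumR-map-cong (λ ks → solve 4 (λ a b c d → (a :* b) :* (c :* d) := (c :* a) :* (b :* d)) refl _ _ _ _)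
                               (compositions m (n ∸ k)) ⟩
            sumR (map (λ ks → qExp y k * compositionWeight xs ks) (compositions m (n ∸ k)))
              ≈⟨ sumR-map-scale (qExp y k) (compositionWeight xs) (compositions m (n ∸ k)) ⟩
            qExp y k * sumR (map (compositionWeight xs) (compositions m (n ∸ k)))
              ≈⟨ *-congˡ (compositions-sum xs (n ∸ k)) ⟩
            qExp y k * qExpProduct xs (n ∸ k) ∎

      H≈qPoch*qExpProduct : ∀ {d} (t : Vec Carrier d) n → H q inv t n ≈ qPoch q n * qExpProduct (t ∷ʳ 1#) n
      H≈qPoch*qExpProduct {d} t n =
        trans (sumR-map-cong (λ ks → *-assoc _ _ _) (compositions (suc d) n))
              (trans (sumR-map-scale (qPoch q n) (compositionWeight (t ∷ʳ 1#)) (compositions (suc d) n))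
                     (*-congˡ (compositions-sum (t ∷ʳ 1#) n)))

      recurrence-term : ∀ {d} (t : Vec Carrier d) e {i n} → i ≤ n →
        qPoch q n * ((pow (- 1#) i * e) * qExpProduct (t ∷ʳ 1#) (n ∸ i)) ≈
        e * (fallingCoeff q n i * H q inv t (n ∸ i))
      recurrence-term t e {i} {n} i≤n = begin
        qPoch q n * ((s * e) * G (n ∸ i))
          ≈⟨ solve 4 (λ p s e g → p :* ((s :* e) :* g) := e :* ((s :* p) :* g)) refl _ _ _ _ ⟩
        e * ((s * qPoch q n) * G (n ∸ i))                         ≈⟨ *-congˡ (*-congʳ (sign-qPoch i≤n)) ⟩
        e * ((fallingCoeff q n i * qPoch q (n ∸ i)) * G (n ∸ i))  ≈⟨ *-congˡ (*-assoc _ _ _) ⟩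
        e * (fallingCoeff q n i * (qPoch q (n ∸ i) * G (n ∸ i)))  ≈⟨ *-congˡ (*-congˡ (sym (H≈qPoch*qExpProduct t (n ∸ i)))) ⟩
        e * (fallingCoeff q n i * H q inv t (n ∸ i))              ∎
        where
          s : Carrier
          s = pow (- 1#) i
          G : Series
          G = qExpProduct (t ∷ʳ 1#)

theorem2p2 : ∀ {c ℓ : Level} (R : CommutativeRing c ℓ) →
    let open CommutativeRing R
        open RS R
    in (q : Carrier) (inv : ℕ → Carrier) →
       (∀ k → qPoch q k * inv k ≈ 1#) →
       (d : ℕ) → 1 ≤ d → (t : Vec Carrier d) → (n : ℕ) →
       H q inv t (suc n) ≈
         sumR (map (λ i → elemSym (suc i) (Vec.toList (t ∷ʳ 1#))
                          * (fallingCoeff q n i * H q inv t (n ∸ i)))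
                   (upTo (suc d)))
theorem2p2 R q inv inv-correct d _ t n = begin
    H q inv t (suc n)                                 ≈⟨ H≈qPoch*qExpProduct t (suc n) ⟩
    qPoch q (suc n) * G (suc n)                       ≈⟨ *-congʳ (qPoch-suc n) ⟩
    (qPoch q n * (1# - pow q (suc n))) * G (suc n)    ≈⟨ *-assoc _ _ _ ⟩
    qPoch q n * ((1# - pow q (suc n)) * G (suc n))    ≈⟨ *-congˡ (qExpProduct-recurrence xs n) ⟩
    qPoch q n * sumBelow term (suc n)                 ≈⟨ sym (sumBelow-scale (qPoch q n) term (suc n)) ⟩
    sumBelow (λ i → qPoch q n * term i) (suc n)       ≈⟨ sumBelow-cong< (suc n) (λ i i<1+n →
                                                           recurrence-term t (e (suc i)) (ℕP.≤-pred i<1+n)) ⟩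
    sumBelow T (suc n)                                ≈⟨ sumBelow-range T beyond-n beyond-d ⟩
    sumBelow T (suc d)                                ≈⟨ sym (sumR-upTo T (suc d)) ⟩
    sumR (map T (upTo (suc d)))                       ∎
  where
    open CommutativeRing R
    open RS R
    open RogersSzegő R
    open QCalculus q
    open QExponential inv inv-correct
    open import Relation.Binary.Reasoning.Setoid setoid

    xs : Vec Carrier (suc d)
    xs = t ∷ʳ 1#
    G : Series
    G = qExpProduct xs
    e : ℕ → Carrier
    e j = elemSym j (Vec.toList xs)
    term T : ℕ → Carrier
    term i = (pow (- 1#) i * e (suc i)) * G (n ∸ i)
    T i = e (suc i) * (fallingCoeff q n i * H q inv t (n ∸ i))

    -- Terms with i > n vanish through the falling factor, those with
    -- i ≥ d + 1 because x has only d + 1 entries.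
    beyond-n : ∀ i → suc n ≤ i → T i ≈ 0#
    beyond-n i n<i = trans (*-congˡ (trans (*-congʳ (fallingCoeff-vanish n i n<i)) (zeroˡ _))) (zeroʳ _)
    beyond-d : ∀ i → suc d ≤ i → T i ≈ 0#
    beyond-d i d<i = trans (*-congʳ (elemSym-vanish (Vec.toList xs) (suc i) length<)) (zeroˡ _)
      where
        length< : length (Vec.toList xs) < suc i
        length< = P.subst (_< suc i) (P.sym (VecP.length-toList xs)) (s≤s d<i)
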